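{- Let $D=(V(D),A(D))$ be a finite directed graph without self-loops that is source-free, i.e., every vertex $v\in V(D)$ has at least one ingoing arc $u\to v$ with $u\in V(D)$. If $D$ has a kernel, then $D$ has a quasi-kernel $Q$ with $|Q|\leq |V(D)|/2$.
   Context: For a directed graph $D$, write $u\to v$ for $(u,v)\in A(D)$. A set $I\subseteq V(D)$ is independent if there are no $u,v\in I$ with $u\to v$. A kernel is an independent set $K\subseteq V(D)$ such that every vertex $v\in V(D)\setminus K$ has an arc $u\to v$ for some $u\in K$. A quasi-kernel is an independent set $Q\subseteq V(D)$ such that every vertex of $V(D)$ either lies in $Q$, or has an in-neighbor in $Q$, or is reachable from some vertex of $Q$ by a directed path of length two (i.e., every vertex is reachable from $Q$ in at most two steps). -}

module Defs where

open import Data.Nat using (ℕ)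
open import Data.Fin using (Fin)
open import Data.Fin.Subset using (Subset; _∈_; _∉_)
open import Data.Product using (∃-syntax; _×_)
open import Data.Sum using (_⊎_)
open import Relation.Nullary using (¬_)
open import Relation.Binary using (Rel; Decidable)
open import Level using (0ℓ)

record Digraph (n : ℕ) : Set₁ where
  field
    Arc  : Rel (Fin n) 0ℓ
    arc? : Decidable Arc
open Digraph public

module _ {n : ℕ} (D : Digraph n) where

  Loopless : Set
  Loopless = ∀ (v : Fin n) → ¬ Arc D v v

  SourceFree : Set
  SourceFree = ∀ (v : Fin n) → ∃[ u ] Arc D u v

  Independent : Subset n → Set
  Independent I = ∀ (u v : Fin n) → u ∈ I → v ∈ I → ¬ Arc D u v

  IsKernel : Subset n → Set
  IsKernel K = Independent K ×
    (∀ (v : Fin n) → v ∉ K → ∃[ u ] (u ∈ K × Arc D u v))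

  IsQuasiKernel : Subset n → Set
  IsQuasiKernel Q = Independent Q ×
    (∀ (v : Fin n) →
        v ∈ Q
      ⊎ (∃[ u ] (u ∈ Q × Arc D u v))
      ⊎ (∃[ u ] ∃[ w ] (u ∈ Q × Arc D u w × Arc D w v)))

{-# OPTIONS --safe #-}
module Submission where

-- If the kernel K has at most n/2 vertices it is itself a quasi-kernel.
-- Otherwise pick, for every vertex outside K, an in-neighbour in K. The
-- chosen vertices form an independent subset of K of size at most n − |K|,
-- so at most n/2; they dominate every vertex outside K, and every vertex of
-- K has an in-neighbour, necessarily outside K, so K is reached in two steps.

open import Defs
open import Data.Nat using (ℕ; suc; _≤_; _<_; _*_; _+_; _∸_; z≤n; s≤s; _≤?_)
open import Data.Nat.Properties
open import Data.Fin using (Fin; zero; suc)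
open import Data.Fin.Subset using (Subset; ∣_∣; _∈_; _∉_; _∪_; ⁅_⁆; ⊥; ∁; inside; outside)
open import Data.Fin.Subset.Properties
  using (_∈?_; ∉⊥; x∈⁅x⁆; x∈⁅y⁆⇒x≡y; x∈∁p⇒x∉p; x∉p⇒x∈∁p; x∈p∪q⁻; x∈p∪q⁺; ∣⁅x⁆∣≡1; ∣∁p∣≡n∸∣p∣; ∣p∣≤n; ∣⊥∣≡0)
open import Data.Vec using (_∷_; []; here; there)
open import Data.Product using (Σ; ∃-syntax; _×_; _,_; proj₁; proj₂)
open import Data.Sum using (_⊎_; inj₁; inj₂)
open import Data.Empty using (⊥-elim)
open import Relation.Nullary using (yes; no)
open import Relation.Binary.PropositionalEquality using (_≡_; sym; cong; subst)

∣p∪q∣≤∣p∣+∣q∣ : ∀ {n} (p q : Subset n) → ∣ p ∪ q ∣ ≤ ∣ p ∣ + ∣ q ∣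
∣p∪q∣≤∣p∣+∣q∣ []            []            = z≤n
∣p∪q∣≤∣p∣+∣q∣ (outside ∷ p) (outside ∷ q) = ∣p∪q∣≤∣p∣+∣q∣ p q
∣p∪q∣≤∣p∣+∣q∣ (outside ∷ p) (inside  ∷ q) =
  subst (suc ∣ p ∪ q ∣ ≤_) (sym (+-suc ∣ p ∣ ∣ q ∣)) (s≤s (∣p∪q∣≤∣p∣+∣q∣ p q))
∣p∪q∣≤∣p∣+∣q∣ (inside  ∷ p) (outside ∷ q) = s≤s (∣p∪q∣≤∣p∣+∣q∣ p q)
∣p∪q∣≤∣p∣+∣q∣ (inside  ∷ p) (inside  ∷ q) =
  s≤s (≤-trans (∣p∪q∣≤∣p∣+∣q∣ p q) (+-monoʳ-≤ ∣ p ∣ (n≤1+n ∣ q ∣)))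

image : ∀ {n m} (p : Subset n) → (∀ s → s ∈ p → Fin m) → Subset m
image []            f = ⊥
image (outside ∷ p) f = image p (λ s s∈p → f (suc s) (there s∈p))
image (inside  ∷ p) f = ⁅ f zero here ⁆ ∪ image p (λ s s∈p → f (suc s) (there s∈p))

∈-image⁺ : ∀ {n m} (p : Subset n) (f : ∀ s → s ∈ p → Fin m) s (s∈p : s ∈ p) →
  f s s∈p ∈ image p f
∈-image⁺ (outside ∷ p) f (suc s) (there s∈p) = ∈-image⁺ p _ s s∈p
∈-image⁺ (inside  ∷ p) f zero    here        = x∈p∪q⁺ (inj₁ (x∈⁅x⁆ _))
∈-image⁺ (inside  ∷ p) f (suc s) (there s∈p) =
  x∈p∪q⁺ {p = ⁅ f zero here ⁆} (inj₂ (∈-image⁺ p _ s s∈p))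

∈-image⁻ : ∀ {n m} (p : Subset n) (f : ∀ s → s ∈ p → Fin m) y → y ∈ image p f →
  ∃[ s ] Σ (s ∈ p) (λ s∈p → y ≡ f s s∈p)
∈-image⁻ []            f y y∈ = ⊥-elim (∉⊥ y∈)
∈-image⁻ (outside ∷ p) f y y∈ with ∈-image⁻ p _ y y∈
... | s , s∈p , y≡ = suc s , there s∈p , y≡
∈-image⁻ (inside  ∷ p) f y y∈ with x∈p∪q⁻ ⁅ f zero here ⁆ _ y∈
... | inj₁ y∈⁅f0⁆ = zero , here , x∈⁅y⁆⇒x≡y _ y∈⁅f0⁆
... | inj₂ y∈rest with ∈-image⁻ p _ y y∈rest
...   | s , s∈p , y≡ = suc s , there s∈p , y≡

∣image∣≤∣p∣ : ∀ {n m} (p : Subset n) (f : ∀ s → s ∈ p → Fin m) → ∣ image p f ∣ ≤ ∣ p ∣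
∣image∣≤∣p∣ {m = m} []  f = ≤-reflexive (∣⊥∣≡0 m)
∣image∣≤∣p∣ (outside ∷ p) f = ∣image∣≤∣p∣ p _
∣image∣≤∣p∣ (inside  ∷ p) f = begin
  ∣ ⁅ f zero here ⁆ ∪ image p _ ∣     ≤⟨ ∣p∪q∣≤∣p∣+∣q∣ ⁅ f zero here ⁆ _ ⟩
  ∣ ⁅ f zero here ⁆ ∣ + ∣ image p _ ∣ ≡⟨ cong (_+ ∣ image p _ ∣) (∣⁅x⁆∣≡1 (f zero here)) ⟩
  suc ∣ image p _ ∣                   ≤⟨ s≤s (∣image∣≤∣p∣ p _) ⟩
  suc ∣ p ∣                           ∎
  where open ≤-Reasoning

m+n≤o⇒2*m≤o⊎2*n≤o : ∀ m n {o} → m + n ≤ o → 2 * m ≤ o ⊎ 2 * n ≤ o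
m+n≤o⇒2*m≤o⊎2*n≤o m n {o} m+n≤o with 2 * m ≤? o
... | yes 2m≤o = inj₁ 2m≤o
... | no  2m≰o = inj₂ (begin
  n + (n + 0) ≡⟨ cong (n +_) (+-identityʳ n) ⟩
  n + n       ≤⟨ +-monoʳ-≤ n (<⇒≤ n<m) ⟩
  n + m       ≡⟨ +-comm n m ⟩
  m + n       ≤⟨ m+n≤o ⟩
  o           ∎)
  where
  open ≤-Reasoning
  n<m : n < m
  n<m = +-cancelˡ-< m n m (≤-<-trans m+n≤o
          (subst (o <_) (cong (m +_) (+-identityʳ m)) (≰⇒> 2m≰o)))

module _ {n : ℕ} (D : Digraph n) {K : Subset n} (kernel : IsKernel D K) where

  private
    independent : Independent D K
    independent = proj₁ kernel

    absorbing : ∀ v → v ∉ K → ∃[ u ] (u ∈ K × Arc D u v)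
    absorbing = proj₂ kernel

  kernel⇒quasiKernel : IsQuasiKernel D K
  kernel⇒quasiKernel = independent , covered
    where
    covered : ∀ v → v ∈ K ⊎ (∃[ u ] (u ∈ K × Arc D u v))
      ⊎ (∃[ u ] ∃[ w ] (u ∈ K × Arc D u w × Arc D w v))
    covered v with v ∈? K
    ... | yes v∈K = inj₁ v∈K
    ... | no  v∉K = inj₂ (inj₁ (absorbing v v∉K))

  dominator : ∀ v → v ∈ ∁ K → Fin n
  dominator v v∈∁K = proj₁ (absorbing v (x∈∁p⇒x∉p v∈∁K))

  dominator∈K : ∀ v (v∈∁K : v ∈ ∁ K) → dominator v v∈∁K ∈ K
  dominator∈K v v∈∁K = proj₁ (proj₂ (absorbing v (x∈∁p⇒x∉p v∈∁K)))

  dominator→ : ∀ v (v∈∁K : v ∈ ∁ K) → Arc D (dominator v v∈∁K) v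
  dominator→ v v∈∁K = proj₂ (proj₂ (absorbing v (x∈∁p⇒x∉p v∈∁K)))

  dominators : Subset n
  dominators = image (∁ K) dominator

  ∣K∣+∣dominators∣≤n : ∣ K ∣ + ∣ dominators ∣ ≤ n
  ∣K∣+∣dominators∣≤n = begin
    ∣ K ∣ + ∣ dominators ∣ ≤⟨ +-monoʳ-≤ ∣ K ∣ (∣image∣≤∣p∣ (∁ K) dominator) ⟩
    ∣ K ∣ + ∣ ∁ K ∣        ≡⟨ cong (∣ K ∣ +_) (∣∁p∣≡n∸∣p∣ K) ⟩
    ∣ K ∣ + (n ∸ ∣ K ∣)    ≡⟨ m+[n∸m]≡n (∣p∣≤n K) ⟩
    n                      ∎
    where open ≤-Reasoning

  dominators⊆K : ∀ {v} → v ∈ dominators → v ∈ K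
  dominators⊆K {v} v∈ with ∈-image⁻ (∁ K) dominator v v∈
  ... | s , s∈∁K , v≡ = subst (_∈ K) (sym v≡) (dominator∈K s s∈∁K)

  dominates : ∀ v → v ∉ K → ∃[ u ] (u ∈ dominators × Arc D u v)
  dominates v v∉K = dominator v v∈∁K , ∈-image⁺ (∁ K) dominator v v∈∁K , dominator→ v v∈∁K
    where v∈∁K = x∉p⇒x∈∁p v∉K

  dominators-quasiKernel : SourceFree D → IsQuasiKernel D dominators
  dominators-quasiKernel sourceFree =
    (λ u v u∈ v∈ → independent u v (dominators⊆K u∈) (dominators⊆K v∈)) , covered
    where
    covered : ∀ v → v ∈ dominators ⊎ (∃[ u ] (u ∈ dominators × Arc D u v))
      ⊎ (∃[ u ] ∃[ w ] (u ∈ dominators × Arc D u w × Arc D w v))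
    covered v with v ∈? K
    ... | no  v∉K = inj₂ (inj₁ (dominates v v∉K))
    ... | yes v∈K with sourceFree v
    ...   | u , u→v with u ∈? K
    ...     | yes u∈K = ⊥-elim (independent u v u∈K v∈K u→v)
    ...     | no  u∉K with dominates u u∉K
    ...       | w , w∈ , w→u = inj₂ (inj₂ (w , u , w∈ , w→u , u→v))

theorem4 : ∀ (n : ℕ) (D : Digraph n) → Loopless D → SourceFree D →
    (∃[ K ] IsKernel D K) →
    ∃[ Q ] (IsQuasiKernel D Q × 2 * ∣ Q ∣ ≤ n)
theorem4 n D _ sourceFree (K , kernel)
  with m+n≤o⇒2*m≤o⊎2*n≤o ∣ K ∣ ∣ dominators D kernel ∣ (∣K∣+∣dominators∣≤n D kernel)
... | inj₁ small = K , kernel⇒quasiKernel D kernel , small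
... | inj₂ small = dominators D kernel , dominators-quasiKernel D kernel sourceFree , small
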